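{- Let $G$ be a finite connected undirected graph and let $k \ge 0$ be an integer. Suppose $G$ has a shortest path $v_0, v_1, \dots, v_t$ of eccentricity $k$. Let $P = x_0, x_1, \dots, x_s$ be any shortest path of $G$, and suppose that at least one vertex $v_i$ ($0 \le i \le t$) satisfies $d(v_i, P) \le k$. Let $i^P_{\min}$ (resp. $i^P_{\max}$) be the smallest (resp. largest) index $i \in \{0,\dots,t\}$ such that $d(v_i, P) \le k$. Then: (1) for every integer $i$ with $i^P_{\min} \le i \le i^P_{\max}$, we have $d(v_i, P) \le 2k$; (2) consequently, every vertex $v$ of $G$ at distance at most $k$ from the subpath $v_{i^P_{\min}}, \dots, v_{i^P_{\max}}$ satisfies $d(v, P) \le 3k$.
   Context: $G=(V,E)$ is a finite connected undirected graph. The distance $d(u,v)$ is the number of edges of a shortest $u$–$v$ path. A shortest path is a path whose length equals the distance between its endpoints; paths are viewed both as sequences and as vertex sets. For a vertex $v$ and a set $S$, $d(v,S)=\min_{u\in S} d(v,u)$. The eccentricity of a set $S$ is $ecc(S)=\max_{v \in V} d(v,S)$. -}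

module Defs where

open import Level using (Level; 0ℓ) renaming (suc to lsuc)
open import Data.Nat using (ℕ; zero; suc; _≤_; _<_)
open import Data.Fin using (Fin; toℕ; inject₁; fromℕ)
open import Data.Product using (Σ; ∃; _×_; _,_)
open import Relation.Binary.PropositionalEquality using (_≡_)
open import Relation.Nullary using (¬_)

record Graph : Set₁ where
  field
    n      : ℕ
    Adj    : Fin n → Fin n → Set
    sym    : ∀ {u v} → Adj u v → Adj v u
    irrefl : ∀ {u} → ¬ Adj u u

module _ (G : Graph) where
  open Graph G

  Vertex : Set
  Vertex = Fin n

  data Walk : Vertex → Vertex → ℕ → Set where
    here : ∀ {u} → Walk u u 0
    step : ∀ {u w v m} → Adj u w → Walk w v m → Walk u v (suc m)

  Connected : Set
  Connected = ∀ u v → ∃ λ m → Walk u v m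

  DistLe : Vertex → Vertex → ℕ → Set
  DistLe u v m = ∃ λ l → l ≤ m × Walk u v l

  Dist : Vertex → Vertex → ℕ → Set
  Dist u v m = Walk u v m × (∀ l → Walk u v l → m ≤ l)

  DistSetLe : Vertex → (Vertex → Set) → ℕ → Set
  DistSetLe v S m = ∃ λ u → S u × DistLe v u m

  -- ecc(S) = k  (max over v of d(v,S) equals k)
  Ecc : (Vertex → Set) → ℕ → Set
  Ecc S k = (∀ v → DistSetLe v S k)
          × (∃ λ v → ∀ m → DistSetLe v S m → k ≤ m)

  -- a path x_0,…,x_t given as a function Fin (suc t) → V, which is shortest:
  -- consecutive vertices are adjacent and d(x_0,x_t) = t
  IsShortestPath : (t : ℕ) → (Fin (suc t) → Vertex) → Set
  IsShortestPath t p =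
    (∀ (i : Fin t) → Adj (p (inject₁ i)) (p (Fin.suc i)))
    × Dist (p Fin.zero) (p (fromℕ t)) t

  PathSet : ∀ {t} → (Fin (suc t) → Vertex) → Vertex → Set
  PathSet {t} p x = ∃ λ (i : Fin (suc t)) → p i ≡ x

  SubPathSet : ∀ {t} → (Fin (suc t) → Vertex) → ℕ → ℕ → Vertex → Set
  SubPathSet {t} p a b x =
    ∃ λ (i : Fin (suc t)) → a ≤ toℕ i × toℕ i ≤ b × p i ≡ x

-- Let the shortest path v have eccentricity k, and walk along P from a vertex near
-- v_imin to a vertex near v_imax.  Every vertex of P is within k of some v_c, so this
-- walk yields a sequence of anchor indices starting at imin and ending at imax.  For
-- imin ≤ i ≤ imax some two consecutive anchors c ≤ i ≤ c′ belong to adjacent vertices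
-- y, y′ of P; since v is shortest, c′ − c ≤ d(v_c, v_c′) ≤ 2k + 1, so i is within k
-- of c or of c′, and then d(v_i, P) ≤ 2k.
-- Only d(v_imin, P), d(v_imax, P) ≤ k is used, not the extremality of imin and imax.
module Submission where

open import Defs
open import Data.Nat using (ℕ; suc; _≤_; _*_)
open import Data.Fin using (Fin; toℕ)
open import Data.Product using (_×_)

open import Data.Nat using (zero; _+_; _∸_; z≤n; _≤?_)
open import Data.Nat.Properties
open import Data.Nat.Tactic.RingSolver using (solve-∀)
open import Data.Fin using (inject₁; fromℕ)
open import Data.Fin.Properties using (toℕ≤pred[n]; toℕ-fromℕ; ≤fromℕ)
open import Data.Product using (_,_; proj₁)
open import Data.Sum using (inj₁; inj₂)
open import Relation.Binary.PropositionalEquality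
open import Relation.Nullary using (yes; no)

-- Indices beyond t are clamped to t, so that a path can be read at any natural number.
clamp : (t : ℕ) → ℕ → Fin (suc t)
clamp t       zero    = Fin.zero
clamp zero    (suc i) = Fin.zero
clamp (suc t) (suc i) = Fin.suc (clamp t i)

clamp-toℕ : ∀ t (i : Fin (suc t)) → clamp t (toℕ i) ≡ i
clamp-toℕ t       Fin.zero    = refl
clamp-toℕ (suc t) (Fin.suc i) = cong Fin.suc (clamp-toℕ t i)

at : ∀ {A : Set} {t} → (Fin (suc t) → A) → ℕ → A
at {t = t} p i = p (clamp t i)

at-toℕ : ∀ {A : Set} {t} (p : Fin (suc t) → A) (i : Fin (suc t)) → at p (toℕ i) ≡ p i
at-toℕ {t = t} p i = cong p (clamp-toℕ t i)

module _ (G : Graph) where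
  open Graph G using (Adj) renaming (sym to Adj-sym)

  _++ʷ_ : ∀ {u w y a b} → Walk G u w a → Walk G w y b → Walk G u y (a + b)
  here       ++ʷ q = q
  step e p   ++ʷ q = step e (p ++ʷ q)

  reverseʷ : ∀ {u w a} → Walk G u w a → Walk G w u a
  reverseʷ here = here
  reverseʷ {a = suc a} (step e p) =
    subst (Walk G _ _) (+-comm a 1) (reverseʷ p ++ʷ step (Adj-sym e) here)

  DistLe-refl : ∀ {u a} → DistLe G u u a
  DistLe-refl = 0 , z≤n , here

  DistLe-sym : ∀ {u w a} → DistLe G u w a → DistLe G w u a
  DistLe-sym (l , l≤a , p) = l , l≤a , reverseʷ p

  DistLe-trans : ∀ {u w y a b} → DistLe G u w a → DistLe G w y b → DistLe G u y (a + b)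
  DistLe-trans (l , l≤a , p) (l′ , l′≤b , q) = l + l′ , +-mono-≤ l≤a l′≤b , p ++ʷ q

  DistLe-mono : ∀ {u w a b} → a ≤ b → DistLe G u w a → DistLe G u w b
  DistLe-mono a≤b (l , l≤a , p) = l , ≤-trans l≤a a≤b , p

  DistSetLe-trans : ∀ {w u S a b} → DistLe G w u a → DistSetLe G u S b → DistSetLe G w S (a + b)
  DistSetLe-trans wu (y , Sy , uy) = y , Sy , DistLe-trans wu uy

  Dist⇒≤ : ∀ {u w d m} → Dist G u w d → DistLe G u w m → d ≤ m
  Dist⇒≤ (_ , minimal) (l , l≤m , p) = ≤-trans (minimal l p) l≤m

  IsPath : ∀ {t} → (Fin (suc t) → Vertex G) → Set
  IsPath {t} p = ∀ (i : Fin t) → Adj (p (inject₁ i)) (p (Fin.suc i))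

  module _ {t} (p : Fin (suc t) → Vertex G) (p-path : IsPath p) where

    at-step : ∀ m → DistLe G (at p m) (at p (suc m)) 1
    at-step = go p p-path
      where
      go : ∀ {t} (p : Fin (suc t) → Vertex G) → IsPath p → ∀ m → DistLe G (at p m) (at p (suc m)) 1
      go {zero}  _ _    zero    = DistLe-refl
      go {zero}  _ _    (suc m) = DistLe-refl
      go {suc t} _ path zero    = 1 , ≤-refl , step (path Fin.zero) here
      go {suc t} p path (suc m) = go (λ i → p (Fin.suc i)) (λ i → path (Fin.suc i)) m

    at-+ : ∀ a d → DistLe G (at p a) (at p (a + d)) d
    at-+ a zero    rewrite +-identityʳ a = DistLe-refl
    at-+ a (suc d) rewrite +-suc a d = DistLe-trans (at-step a) (at-+ (suc a) d)

    path-∸ : ∀ (i j : Fin (suc t)) → toℕ i ≤ toℕ j → DistLe G (p i) (p j) (toℕ j ∸ toℕ i)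
    path-∸ i j i≤j = subst₂ (λ u w → DistLe G u w (toℕ j ∸ toℕ i)) (at-toℕ p i) (at-toℕ p j)
      (subst (λ b → DistLe G (at p (toℕ i)) (at p b) (toℕ j ∸ toℕ i)) (m+[n∸m]≡n i≤j)
        (at-+ (toℕ i) (toℕ j ∸ toℕ i)))

    path-close : ∀ {k} (i j : Fin (suc t)) → toℕ i ≤ toℕ j → toℕ j ≤ toℕ i + k → DistLe G (p i) (p j) k
    path-close i j i≤j j≤i+k = DistLe-mono (m≤n+o⇒m∸n≤o (toℕ j) (toℕ i) j≤i+k) (path-∸ i j i≤j)

  shortest-index-bound : ∀ {t m} {p : Fin (suc t) → Vertex G} → IsShortestPath G t p
    → (i j : Fin (suc t)) → toℕ i ≤ toℕ j → DistLe G (p i) (p j) m → toℕ j ≤ toℕ i + m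
  shortest-index-bound {t} {m} {p} (p-path , p-dist) i j i≤j ij =
    +-cancelʳ-≤ (t ∸ toℕ j) (toℕ j) (toℕ i + m) (begin
      toℕ j + (t ∸ toℕ j)           ≡⟨ m+[n∸m]≡n (toℕ≤pred[n] j) ⟩
      t                             ≤⟨ Dist⇒≤ p-dist (DistLe-trans (path-∸ p p-path Fin.zero i z≤n) (DistLe-trans ij jt)) ⟩
      toℕ i + (m + (t ∸ toℕ j))     ≡⟨ +-assoc (toℕ i) m (t ∸ toℕ j) ⟨
      toℕ i + m + (t ∸ toℕ j)       ∎)
    where
    open ≤-Reasoning
    jt : DistLe G (p j) (p (fromℕ t)) (t ∸ toℕ j)
    jt = subst (λ b → DistLe G (p j) (p (fromℕ t)) (b ∸ toℕ j)) (toℕ-fromℕ t)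
      (path-∸ p p-path j (fromℕ t) (≤fromℕ j))

  data Chain (S : Vertex G → Set) : Vertex G → Vertex G → Set where
    end  : ∀ {u} → S u → Chain S u u
    link : ∀ {u w y} → S u → DistLe G u w 1 → Chain S w y → Chain S u y

  chain-head : ∀ {S u w} → Chain S u w → S u
  chain-head (end Su)      = Su
  chain-head (link Su _ _) = Su

  module _ {t} (p : Fin (suc t) → Vertex G) (p-path : IsPath p) where

    at-on-path : ∀ m → PathSet G p (at p m)
    at-on-path m = clamp t m , refl

    chain-up : ∀ a d → Chain (PathSet G p) (at p a) (at p (a + d))
    chain-up a zero    rewrite +-identityʳ a = end (at-on-path a)
    chain-up a (suc d) rewrite +-suc a d = link (at-on-path a) (at-step p p-path a) (chain-up (suc a) d)

    chain-down : ∀ a d → Chain (PathSet G p) (at p (a + d)) (at p a)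
    chain-down a zero    rewrite +-identityʳ a = end (at-on-path a)
    chain-down a (suc d) rewrite +-suc a d =
      link (at-on-path (suc (a + d))) (DistLe-sym (at-step p p-path (a + d))) (chain-down a d)

    chain-at : ∀ a b → Chain (PathSet G p) (at p a) (at p b)
    chain-at a b with ≤-total a b
    ... | inj₁ a≤b with m≤n⇒∃[o]m+o≡n a≤b
    ...   | d , refl = chain-up a d
    chain-at a b | inj₂ b≤a with m≤n⇒∃[o]m+o≡n b≤a
    ...   | d , refl = chain-down b d

    chain-between : ∀ (i j : Fin (suc t)) → Chain (PathSet G p) (p i) (p j)
    chain-between i j = subst₂ (Chain _) (at-toℕ p i) (at-toℕ p j) (chain-at (toℕ i) (toℕ j))

  module _ {t} {v : Fin (suc t) → Vertex G} (v-shortest : IsShortestPath G t v)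
           (k : ℕ) (S : Vertex G → Set) where

    covered-between-anchors : ∀ {y y′} (c i c′ : Fin (suc t)) → S y → S y′ → DistLe G y y′ 1
      → DistLe G (v c) y k → DistLe G (v c′) y′ k → toℕ c ≤ toℕ i → toℕ i ≤ toℕ c′
      → DistSetLe G (v i) S (k + k)
    covered-between-anchors {y} {y′} c i c′ Sy Sy′ yy′ cy c′y′ c≤i i≤c′ with toℕ i ≤? toℕ c + k
    ... | yes i≤c+k = DistSetLe-trans (DistLe-sym (path-close v (proj₁ v-shortest) c i c≤i i≤c+k)) (y , Sy , cy)
    ... | no  i≰c+k = DistSetLe-trans (path-close v (proj₁ v-shortest) i c′ i≤c′ c′≤i+k) (y′ , Sy′ , c′y′)
      where
      open ≤-Reasoning
      rearrange : ∀ a k → a + (k + (1 + k)) ≡ suc (a + k) + k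
      rearrange = solve-∀
      c′≤i+k : toℕ c′ ≤ toℕ i + k
      c′≤i+k = begin
        toℕ c′                   ≤⟨ shortest-index-bound v-shortest c c′ (≤-trans c≤i i≤c′)
                                      (DistLe-trans cy (DistLe-trans yy′ (DistLe-sym c′y′))) ⟩
        toℕ c + (k + (1 + k))    ≡⟨ rearrange (toℕ c) k ⟩
        suc (toℕ c + k) + k      ≤⟨ +-monoˡ-≤ k (≰⇒> i≰c+k) ⟩
        toℕ i + k                ∎

    covered-along-chain : (∀ w → DistSetLe G w (PathSet G v) k)
      → ∀ {y z} → Chain S y z → (c i c′ : Fin (suc t))
      → DistLe G (v c) y k → DistLe G (v c′) z k → toℕ c ≤ toℕ i → toℕ i ≤ toℕ c′
      → DistSetLe G (v i) S (k + k)
    covered-along-chain _ (end Sy) c i c′ cy c′y c≤i i≤c′ =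
      covered-between-anchors c i c′ Sy Sy DistLe-refl cy c′y c≤i i≤c′
    covered-along-chain v-near (link {w = w} Sy yw chain) c i c′ cy c′z c≤i i≤c′
      with v-near w
    ... | _ , (d , refl) , wd with toℕ i ≤? toℕ d
    ...   | yes i≤d = covered-between-anchors c i d Sy (chain-head chain) yw cy (DistLe-sym wd) c≤i i≤d
    ...   | no  i≰d = covered-along-chain v-near chain d i c′ (DistLe-sym wd) c′z (<⇒≤ (≰⇒> i≰d)) i≤c′

lemma1 : (G : Graph) → Connected G → (k : ℕ)
    → (t : ℕ) (v : Fin (suc t) → Vertex G)
    → IsShortestPath G t v → Ecc G (PathSet G v) k
    → (s : ℕ) (x : Fin (suc s) → Vertex G) → IsShortestPath G s x
    → (imin imax : Fin (suc t))
    → DistSetLe G (v imin) (PathSet G x) k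
    → (∀ (i : Fin (suc t)) → DistSetLe G (v i) (PathSet G x) k → toℕ imin ≤ toℕ i)
    → DistSetLe G (v imax) (PathSet G x) k
    → (∀ (i : Fin (suc t)) → DistSetLe G (v i) (PathSet G x) k → toℕ i ≤ toℕ imax)
    → (∀ (i : Fin (suc t)) → toℕ imin ≤ toℕ i → toℕ i ≤ toℕ imax
    → DistSetLe G (v i) (PathSet G x) (2 * k))
    × (∀ (w : Vertex G) → DistSetLe G w (SubPathSet G v (toℕ imin) (toℕ imax)) k
    → DistSetLe G w (PathSet G x) (3 * k))
lemma1 G _ k t v v-shortest (v-near , _) s x (x-path , _) imin imax
       (_ , (a , refl) , imin-a) _ (_ , (b , refl) , imax-b) _ = near-P , near-subpath
  where
  near-P : ∀ i → toℕ imin ≤ toℕ i → toℕ i ≤ toℕ imax → DistSetLe G (v i) (PathSet G x) (2 * k)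
  near-P i imin≤i i≤imax
    with covered-along-chain G v-shortest k (PathSet G x) v-near (chain-between G x x-path a b)
           imin i imax imin-a imax-b imin≤i i≤imax
  ... | y , Py , iy = y , Py , DistLe-mono G (≤-reflexive (cong (k +_) (sym (+-identityʳ k)))) iy

  near-subpath : ∀ w → DistSetLe G w (SubPathSet G v (toℕ imin) (toℕ imax)) k
               → DistSetLe G w (PathSet G x) (3 * k)
  near-subpath w (_ , (i , imin≤i , i≤imax , refl) , wi) =
    DistSetLe-trans G wi (near-P i imin≤i i≤imax)
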